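{- For every integer $N\ge 1$, the map $\Phi$ described below is a bijection from the set of multi-edge trees with $N$ edges (counted with multiplicity) onto the set of 3-coloured Motzkin paths of length $N-1$. In particular, both sets have the same cardinality, namely the coefficient of $z^N$ in $F(z)=\frac{1-z-\sqrt{1-6z+5z^2}}{2z}$. The map $\Phi$: let $T$ be a multi-edge tree whose underlying ordered tree has $n\ge 1$ edges $e_1,\dots,e_n$ listed in pre-order, with multiplicities $a_1,\dots,a_n\ge 1$, so $N=a_1+\cdots+a_n$. (1) Ignoring multiplicities, encode the underlying ordered tree by the standard Dyck path of length $2n$: traverse the tree depth-first from the root (children visited left to right), writing an up-step $U$ each time an edge is traversed downward and a down-step $D$ each time it is traversed upward. (2) Delete the first step (a $U$) and the last step (a $D$) of this Dyck path, and split the remaining $2n-2$ steps into $n-1$ consecutive pairs. Replace each pair by one step: $UU\mapsto$ up-step, $DD\mapsto$ down-step, $UD\mapsto$ red horizontal step, $DU\mapsto$ green horizontal step. This yields a Motzkin path of length $n-1$ using red and green horizontal steps. (3) This path has $n-1$ steps, hence $n$ gaps (before the first step, between consecutive steps, after the last step), numbered $1,\dots,n$ from left to right. For each $i=1,\dots,n$, insert $a_i-1$ blue horizontal steps into gap $i$. The result is $\Phi(T)$, a 3-coloured Motzkin path of length $(n-1)+\sum_i(a_i-1)=N-1$.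
   Context: A multi-edge tree is an ordered (plane) rooted tree in which each edge carries a positive integer label, its multiplicity (representing that many parallel edges); the number of edges of a multi-edge tree is the sum of the multiplicities of its edges. A 3-coloured Motzkin path of length $m$ is a sequence of $m$ steps, each an up-step $(1,1)$, a down-step $(1,-1)$, or a horizontal step $(1,0)$ coloured one of three colours (red, green, blue), starting at the origin, ending on the $x$-axis, and never going below the $x$-axis. Pre-order of the edges means the order in which edges are first traversed in the depth-first, left-to-right traversal from the root. -}

module Defs where

open import Data.Nat using (ℕ; zero; suc; _+_; _∸_; _≤_)
open import Data.List using (List; []; _∷_; _++_; [_]; replicate; map; upTo; foldr; length)
open import Data.Product using (_×_; _,_; Σ)
open import Data.Unit using (⊤)
open import Data.Integer using (+_; -[1+_])
open import Data.Rational using (ℚ; _/_; ½; 0ℚ; 1ℚ) renaming (_+_ to _+ℚ_; _*_ to _*ℚ_; _-_ to _-ℚ_)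
open import Relation.Binary.PropositionalEquality using (_≡_)

-- An ordered (plane) rooted tree whose edges carry a natural-number label.
-- A node is the ordered list of its children; each child comes with the
-- label (multiplicity) of the edge leading to it.
data MTree : Set where
  node : List (ℕ × MTree) → MTree

mutual
  ValidTree : MTree → Set
  ValidTree (node cs) = ValidForest cs

  ValidForest : List (ℕ × MTree) → Set
  ValidForest []            = ⊤
  ValidForest ((a , t) ∷ cs) = (1 ≤ a) × ValidTree t × ValidForest cs

mutual
  edges : MTree → ℕ
  edges (node cs) = edgesF cs

  edgesF : List (ℕ × MTree) → ℕ
  edgesF []             = 0
  edgesF ((a , t) ∷ cs) = a + edges t + edgesF cs

mutual
  preMults : MTree → List ℕ
  preMults (node cs) = preMultsF cs

  preMultsF : List (ℕ × MTree) → List ℕ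
  preMultsF []             = []
  preMultsF ((a , t) ∷ cs) = a ∷ preMults t ++ preMultsF cs

data Colour : Set where
  red green blue : Colour

-- U = up-step (1,1), D = down-step (1,-1), H c = horizontal step of colour c.
data Step : Set where
  U D : Step
  H   : Colour → Step

-- Walk h p : the path p, started at height h, never goes below the
-- x-axis and ends on the x-axis.
data Walk : ℕ → List Step → Set where
  done : Walk 0 []
  up   : ∀ {h p} → Walk (suc h) p → Walk h (U ∷ p)
  down : ∀ {h p} → Walk h p → Walk (suc h) (D ∷ p)
  flat : ∀ {h p} c → Walk h p → Walk h (H c ∷ p)

IsMotzkin : List Step → Set
IsMotzkin p = Walk 0 p

mutual
  dyck : MTree → List Step
  dyck (node cs) = dyckF cs

  dyckF : List (ℕ × MTree) → List Step
  dyckF []             = []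
  dyckF ((a , t) ∷ cs) = (U ∷ dyck t ++ [ D ]) ++ dyckF cs

dropFirst : List Step → List Step
dropFirst []      = []
dropFirst (_ ∷ p) = p

dropLast : List Step → List Step
dropLast []          = []
dropLast (x ∷ [])    = []
dropLast (x ∷ y ∷ p) = x ∷ dropLast (y ∷ p)

pairStep : Step → Step → Step
pairStep U U = U
pairStep D D = D
pairStep U D = H red
pairStep D U = H green
pairStep _ _ = H blue   -- never occurs for Dyck-path input

pairUp : List Step → List Step
pairUp (x ∷ y ∷ p) = pairStep x y ∷ pairUp p
pairUp _           = []

-- (3) insert (a_i - 1) blue steps into gap i (gap i is just before step i;
-- gap n is after the last step)
blues : ℕ → List Step
blues a = replicate (a ∸ 1) (H blue)

insertBlues : List ℕ → List Step → List Step
insertBlues []       p       = p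
insertBlues (a ∷ as) []      = blues a ++ insertBlues as []
insertBlues (a ∷ as) (x ∷ p) = blues a ++ (x ∷ insertBlues as p)

Φ : MTree → List Step
Φ t = insertBlues (preMults t) (pairUp (dropLast (dropFirst (dyck t))))

hCoef : ℕ → ℚ
hCoef 0 = 1ℚ
hCoef 1 = -[1+ 5 ] / 1
hCoef 2 = + 5 / 1
hCoef _ = 0ℚ

at : List ℚ → ℕ → ℚ
at []       _       = 0ℚ
at (x ∷ xs) zero    = x
at (x ∷ xs) (suc i) = at xs i

sumℚ : List ℚ → ℚ
sumℚ = foldr _+ℚ_ 0ℚ

-- sqrtPrefix n = coefficients g_0 … g_n of the formal square root g of
-- 1 - 6z + 5z² with g_0 = 1, i.e. the unique series with g_0 = 1 and
-- g² = 1 - 6z + 5z²:  g_m = (h_m - Σ_{i=1}^{m-1} g_i g_{m-i}) / 2.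
sqrtPrefix : ℕ → List ℚ
sqrtPrefix zero    = [ 1ℚ ]
sqrtPrefix (suc n) =
  sqrtPrefix n ++
  [ (hCoef (suc n) -ℚ sumℚ (map (λ i → at (sqrtPrefix n) (suc i) *ℚ at (sqrtPrefix n) (n ∸ i)) (upTo n))) *ℚ ½ ]

sqrtCoef : ℕ → ℚ
sqrtCoef n = at (sqrtPrefix n) n

numCoef : ℕ → ℚ
numCoef 0 = 1ℚ -ℚ sqrtCoef 0
numCoef 1 = 0ℚ -ℚ 1ℚ -ℚ sqrtCoef 1
numCoef n = 0ℚ -ℚ sqrtCoef n

-- [z^N] F(z) = ([z^(N+1)] numerator) / 2
FCoef : ℕ → ℚ
FCoef N = numCoef (suc N) *ℚ ½

MultiEdgeTrees : ℕ → Set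
MultiEdgeTrees N = Σ MTree (λ t → ValidTree t × edges t ≡ N)

MotzkinPaths : ℕ → Set
MotzkinPaths m = Σ (List Step) (λ p → IsMotzkin p × length p ≡ m)

{-# OPTIONS --safe #-}

-- Φ is a composite of bijections. The Dyck path of a tree with n ≥ 1 edges is U w D, where w is a
-- Dyck path from height 1; pairing its steps gives a red-green Motzkin path q of length n - 1, and
-- unpairing inverts this. The pre-order multiplicities form a list of n positive numbers, one per gap
-- of q, and inserting the blue steps is inverted by reading off the maximal blue runs. Finally the
-- Dyck path and the multiplicities together determine the tree.
--
-- For the count, walks of length m from height h are counted by their first step, and the
-- first-return decomposition of walks from height 1 gives the Motzkin recurrence
-- M(m + 1) = 3 M(m) + Σ M(i) M(m - 1 - i). This recurrence says precisely that
-- 1 - 3z - 2z² Σ M(m) zᵐ squares to 1 - 6z + 5z², which identifies it with the power series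
-- square root defining F.

module Submission where

open import Defs
open import Data.Nat using (ℕ; zero; suc; _+_; _*_; _∸_; _≤_; _<_; z≤n; s≤s; z<s; s<s)
open import Data.Nat.Properties
open import Data.Nat.ListAction using (sum)
open import Data.Nat.ListAction.Properties using (sum-++)
open import Data.List using (List; []; _∷_; _++_; [_]; length; replicate; map; applyUpTo; upTo)
open import Data.List.Properties using (++-assoc; ++-identityʳ; length-++; length-replicate; ∷-injectiveˡ; ∷-injectiveʳ; map-applyUpTo; applyUpTo-∷ʳ; map-cong-local)
open import Data.List.Relation.Unary.All using (All; []; _∷_)
import Data.List.Relation.Unary.All.Properties as All
open import Data.Vec using (Vec; []; _∷_)
open import Data.Product using (Σ; Σ-syntax; ∃; _×_; _,_; proj₁; proj₂; uncurry)
import Data.Product as Product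
open import Data.Sum using (_⊎_; inj₁; inj₂)
open import Data.Unit using (⊤; tt)
open import Data.Empty using (⊥; ⊥-elim)
open import Data.Fin using (Fin)
import Data.Nat.Coprimality as Coprimality
open import Data.Integer using (+_)
import Data.Integer as ℤ
import Data.Integer.Properties as ℤ
import Data.Rational as ℚ
open ℚ using (ℚ; mkℚ; _/_; 0ℚ; 1ℚ; ½)
import Data.Rational.Properties as ℚ
open import Data.Rational.Solver using (module +-*-Solver)
open import Data.Fin.Properties using (+↔⊎; *↔×)
open import Data.Fin.Permutation using (↔⇒≡)
open import Function using (_∘_; id)
open import Function.Bundles using (_↔_; mk↔ₛ′; mk⤖)
open import Function.Definitions using (Injective; Surjective)
open import Function.Properties.Bijection using (⤖⇒↔)
open import Function.Properties.Inverse using (↔-trans; ↔-sym)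
open import Data.Sum.Function.Propositional using (_⊎-↔_)
open import Data.Product.Function.NonDependent.Propositional using (_×-↔_)
open import Relation.Binary.PropositionalEquality hiding ([_])

Forest : Set
Forest = List (ℕ × MTree)

mutual
  positive⇒ValidTree : ∀ t → All (1 ≤_) (preMults t) → ValidTree t
  positive⇒ValidTree (node cs) = positive⇒ValidForest cs

  positive⇒ValidForest : ∀ cs → All (1 ≤_) (preMultsF cs) → ValidForest cs
  positive⇒ValidForest []             _          = tt
  positive⇒ValidForest ((a , t) ∷ cs) (1≤a ∷ ps) =
    1≤a , positive⇒ValidTree t (All.++⁻ˡ (preMults t) ps) , positive⇒ValidForest cs (All.++⁻ʳ (preMults t) ps)

mutual
  ValidTree⇒positive : ∀ t → ValidTree t → All (1 ≤_) (preMults t)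
  ValidTree⇒positive (node cs) = ValidForest⇒positive cs

  ValidForest⇒positive : ∀ cs → ValidForest cs → All (1 ≤_) (preMultsF cs)
  ValidForest⇒positive []             _              = []
  ValidForest⇒positive ((a , t) ∷ cs) (1≤a , v , vs) =
    1≤a ∷ All.++⁺ (ValidTree⇒positive t v) (ValidForest⇒positive cs vs)

mutual
  edges≡sum-preMults : ∀ t → edges t ≡ sum (preMults t)
  edges≡sum-preMults (node cs) = edgesF≡sum-preMultsF cs

  edgesF≡sum-preMultsF : ∀ cs → edgesF cs ≡ sum (preMultsF cs)
  edgesF≡sum-preMultsF []             = refl
  edgesF≡sum-preMultsF ((a , t) ∷ cs) = begin
    a + edges t + edgesF cs                      ≡⟨ +-assoc a (edges t) (edgesF cs) ⟩
    a + (edges t + edgesF cs)                    ≡⟨ cong₂ (λ m n → a + (m + n)) (edges≡sum-preMults t) (edgesF≡sum-preMultsF cs) ⟩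
    a + (sum (preMults t) + sum (preMultsF cs))  ≡⟨ cong (_+_ a) (sum-++ (preMults t) (preMultsF cs)) ⟨
    a + sum (preMults t ++ preMultsF cs)         ∎
    where open ≡-Reasoning

dyckF-∷ : ∀ a t cs → dyckF ((a , t) ∷ cs) ≡ U ∷ dyck t ++ D ∷ dyckF cs
dyckF-∷ a t cs = cong (U ∷_) (++-assoc (dyck t) [ D ] (dyckF cs))

dyckF-∷-++ : ∀ a t cs r → dyckF ((a , t) ∷ cs) ++ r ≡ U ∷ dyck t ++ D ∷ dyckF cs ++ r
dyckF-∷-++ a t cs r = trans (cong (_++ r) (dyckF-∷ a t cs)) (cong (U ∷_) (++-assoc (dyck t) (D ∷ dyckF cs) r))

dyckF-nonempty : ∀ e cs → ∃ λ w → dyckF (e ∷ cs) ≡ U ∷ w ++ [ D ]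
dyckF-nonempty (a , t) []       = dyck t , dyckF-∷ a t []
dyckF-nonempty (a , t) (e ∷ cs) with dyckF-nonempty e cs
... | w , eq = dyck t ++ D ∷ U ∷ w , (begin
  dyckF ((a , t) ∷ e ∷ cs)           ≡⟨ dyckF-∷ a t (e ∷ cs) ⟩
  U ∷ dyck t ++ D ∷ dyckF (e ∷ cs)   ≡⟨ cong (λ r → U ∷ dyck t ++ D ∷ r) eq ⟩
  U ∷ dyck t ++ D ∷ U ∷ w ++ [ D ]   ≡⟨ cong (U ∷_) (++-assoc (dyck t) (D ∷ U ∷ w) [ D ]) ⟨
  U ∷ (dyck t ++ D ∷ U ∷ w) ++ [ D ] ∎)
  where open ≡-Reasoning

double : ℕ → ℕ
double zero    = zero
double (suc n) = suc (suc (double n))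

double-+ : ∀ m n → double (m + n) ≡ double m + double n
double-+ zero    n = refl
double-+ (suc m) n = cong (suc ∘ suc) (double-+ m n)

double-injective : ∀ {m n} → double m ≡ double n → m ≡ n
double-injective {zero}  {zero}  _  = refl
double-injective {suc m} {suc n} eq = cong suc (double-injective (suc-injective (suc-injective eq)))

mutual
  length-dyck : ∀ t → length (dyck t) ≡ double (length (preMults t))
  length-dyck (node cs) = length-dyckF cs

  length-dyckF : ∀ cs → length (dyckF cs) ≡ double (length (preMultsF cs))
  length-dyckF []             = refl
  length-dyckF ((a , t) ∷ cs) = begin
    length (dyckF ((a , t) ∷ cs))                         ≡⟨ cong length (dyckF-∷ a t cs) ⟩
    suc (length (dyck t ++ D ∷ dyckF cs))                 ≡⟨ cong suc (length-++ (dyck t)) ⟩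
    suc (length (dyck t) + suc (length (dyckF cs)))       ≡⟨ cong suc (+-suc (length (dyck t)) _) ⟩
    suc (suc (length (dyck t) + length (dyckF cs)))       ≡⟨ cong₂ (λ m n → suc (suc (m + n))) (length-dyck t) (length-dyckF cs) ⟩
    suc (suc (double (length (preMults t)) + double (length (preMultsF cs))))
                                                          ≡⟨ cong (suc ∘ suc) (double-+ (length (preMults t)) _) ⟨
    double (suc (length (preMults t) + length (preMultsF cs)))
                                                          ≡⟨ cong (double ∘ suc) (length-++ (preMults t)) ⟨
    double (length (preMultsF ((a , t) ∷ cs)))            ∎
    where open ≡-Reasoning

data Dyck : ℕ → List Step → Set where
  done : Dyck 0 []
  up   : ∀ {h w} → Dyck (suc h) w → Dyck h (U ∷ w)
  down : ∀ {h w} → Dyck h w → Dyck (suc h) (D ∷ w)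

mutual
  Dyck-dyck : ∀ t {h r} → Dyck h r → Dyck h (dyck t ++ r)
  Dyck-dyck (node cs) = Dyck-dyckF cs

  Dyck-dyckF : ∀ cs {h r} → Dyck h r → Dyck h (dyckF cs ++ r)
  Dyck-dyckF []             d = d
  Dyck-dyckF ((a , t) ∷ cs) {r = r} d =
    subst (Dyck _) (sym (dyckF-∷-++ a t cs r)) (up (Dyck-dyck t (down (Dyck-dyckF cs d))))

-- Pairing Dyck steps into red-green Motzkin steps

NonBlue : Step → Set
NonBlue (H blue) = ⊥
NonBlue _        = ⊤

unpairStep : Step → List Step
unpairStep U         = U ∷ U ∷ []
unpairStep D         = D ∷ D ∷ []
unpairStep (H red)   = U ∷ D ∷ []
unpairStep (H green) = D ∷ U ∷ []
unpairStep (H blue)  = []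

unpair : List Step → List Step
unpair []      = []
unpair (s ∷ q) = unpairStep s ++ unpair q

pairUp-unpair : ∀ {q} → All NonBlue q → pairUp (unpair q) ≡ q
pairUp-unpair {[]}          []        = refl
pairUp-unpair {U ∷ q}       (_ ∷ nbs) = cong (U ∷_) (pairUp-unpair nbs)
pairUp-unpair {D ∷ q}       (_ ∷ nbs) = cong (D ∷_) (pairUp-unpair nbs)
pairUp-unpair {H red ∷ q}   (_ ∷ nbs) = cong (H red ∷_) (pairUp-unpair nbs)
pairUp-unpair {H green ∷ q} (_ ∷ nbs) = cong (H green ∷_) (pairUp-unpair nbs)

length-unpair : ∀ {q} → All NonBlue q → length (unpair q) ≡ double (length q)
length-unpair {[]}          []        = refl
length-unpair {U ∷ q}       (_ ∷ nbs) = cong (suc ∘ suc) (length-unpair nbs)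
length-unpair {D ∷ q}       (_ ∷ nbs) = cong (suc ∘ suc) (length-unpair nbs)
length-unpair {H red ∷ q}   (_ ∷ nbs) = cong (suc ∘ suc) (length-unpair nbs)
length-unpair {H green ∷ q} (_ ∷ nbs) = cong (suc ∘ suc) (length-unpair nbs)

Dyck-unpair : ∀ {k q} → Walk k q → All NonBlue q → Dyck (suc (double k)) (unpair q ++ [ D ])
Dyck-unpair done             []        = down done
Dyck-unpair (up w)           (_ ∷ nbs) = up (up (Dyck-unpair w nbs))
Dyck-unpair (down w)         (_ ∷ nbs) = down (down (Dyck-unpair w nbs))
Dyck-unpair (flat red w)     (_ ∷ nbs) = up (down (Dyck-unpair w nbs))
Dyck-unpair (flat green w)   (_ ∷ nbs) = down (up (Dyck-unpair w nbs))

-- A pair of steps moves the height by twice a Motzkin step, so from height 2k + 1 the pairs trace a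
-- Motzkin path from height k; parity rules out an unpaired last step.
Dyck⇒unpair : ∀ {k} w → Dyck (suc (double k)) (w ++ [ D ]) →
              Σ[ q ∈ List Step ] Walk k q × All NonBlue q × w ≡ unpair q
Dyck⇒unpair {zero}  []          (down done)       = [] , done , [] , refl
Dyck⇒unpair {suc k} []          (down ())
Dyck⇒unpair         (U ∷ [])    (up (down ()))
Dyck⇒unpair {zero}  (D ∷ [])    (down ())
Dyck⇒unpair {suc k} (D ∷ [])    (down (down ()))
Dyck⇒unpair         (U ∷ U ∷ w) (up (up d))       with Dyck⇒unpair w d
... | q , wq , nbs , refl = U ∷ q , up wq , tt ∷ nbs , refl
Dyck⇒unpair         (U ∷ D ∷ w) (up (down d))     with Dyck⇒unpair w d
... | q , wq , nbs , refl = H red ∷ q , flat red wq , tt ∷ nbs , refl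
Dyck⇒unpair         (D ∷ U ∷ w) (down (up d))     with Dyck⇒unpair w d
... | q , wq , nbs , refl = H green ∷ q , flat green wq , tt ∷ nbs , refl
Dyck⇒unpair {suc k} (D ∷ D ∷ w) (down (down d))   with Dyck⇒unpair w d
... | q , wq , nbs , refl = D ∷ q , down wq , tt ∷ nbs , refl
Dyck⇒unpair {zero}  (D ∷ D ∷ w) (down ())

dropLast-∷ʳ : ∀ w x → dropLast (w ++ [ x ]) ≡ w
dropLast-∷ʳ []          x = refl
dropLast-∷ʳ (y ∷ [])    x = refl
dropLast-∷ʳ (y ∷ z ∷ w) x = cong (y ∷_) (dropLast-∷ʳ (z ∷ w) x)

record Skeleton (t : MTree) (q : List Step) : Set where
  field
    walk    : Walk 0 q
    nonBlue : All NonBlue q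
    dyck≡   : dyck t ≡ U ∷ unpair q ++ [ D ]

skeleton : ∀ e cs → ∃ (Skeleton (node (e ∷ cs)))
skeleton e cs with dyckF-nonempty e cs
... | w , eq with subst (Dyck 0) (trans (++-identityʳ (dyckF (e ∷ cs))) eq) (Dyck-dyckF (e ∷ cs) done)
... | up d with Dyck⇒unpair w d
... | q , wq , nbs , w≡ = q , record { walk = wq ; nonBlue = nbs ; dyck≡ = trans eq (cong (λ v → U ∷ v ++ [ D ]) w≡) }

module _ {t q} (s : Skeleton t q) where
  open Skeleton s

  Φ≡insertBlues : Φ t ≡ insertBlues (preMults t) q
  Φ≡insertBlues = cong (insertBlues (preMults t)) (begin
    pairUp (dropLast (dropFirst (dyck t)))  ≡⟨ cong (pairUp ∘ dropLast ∘ dropFirst) dyck≡ ⟩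
    pairUp (dropLast (unpair q ++ [ D ]))   ≡⟨ cong pairUp (dropLast-∷ʳ (unpair q) D) ⟩
    pairUp (unpair q)                       ≡⟨ pairUp-unpair nonBlue ⟩
    q                                       ∎)
    where open ≡-Reasoning

  length-preMults : length (preMults t) ≡ suc (length q)
  length-preMults = double-injective (begin
    double (length (preMults t))         ≡⟨ length-dyck t ⟨
    length (dyck t)                      ≡⟨ cong length dyck≡ ⟩
    suc (length (unpair q ++ [ D ]))     ≡⟨ cong suc (length-++ (unpair q)) ⟩
    suc (length (unpair q) + 1)          ≡⟨ cong suc (+-comm (length (unpair q)) 1) ⟩
    suc (suc (length (unpair q)))        ≡⟨ cong (suc ∘ suc) (length-unpair nonBlue) ⟩
    double (suc (length q))              ∎)
    where open ≡-Reasoning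

-- Blue steps

Insertable : List ℕ → List Step → Set
Insertable as q = All (1 ≤_) as × All NonBlue q × length as ≡ suc (length q)

Walk-blues : ∀ n {h r} → Walk h r → Walk h (replicate n (H blue) ++ r)
Walk-blues zero    w = w
Walk-blues (suc n) w = flat blue (Walk-blues n w)

Walk-insertBlues : ∀ as {h q} → Walk h q → Walk h (insertBlues as q)
Walk-insertBlues []       w          = w
Walk-insertBlues (a ∷ as) done       = Walk-blues (a ∸ 1) (Walk-insertBlues as done)
Walk-insertBlues (a ∷ as) (up w)     = Walk-blues (a ∸ 1) (up (Walk-insertBlues as w))
Walk-insertBlues (a ∷ as) (down w)   = Walk-blues (a ∸ 1) (down (Walk-insertBlues as w))
Walk-insertBlues (a ∷ as) (flat c w) = Walk-blues (a ∸ 1) (flat c (Walk-insertBlues as w))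

length-insertBlues : ∀ as q → length (insertBlues as q) ≡ sum (map (_∸ 1) as) + length q
length-insertBlues []       q       = refl
length-insertBlues (a ∷ as) []      = begin
  length (blues a ++ insertBlues as [])              ≡⟨ length-++ (blues a) ⟩
  length (blues a) + length (insertBlues as [])      ≡⟨ cong₂ _+_ (length-replicate (a ∸ 1)) (length-insertBlues as []) ⟩
  a ∸ 1 + (sum (map (_∸ 1) as) + 0)                  ≡⟨ +-assoc (a ∸ 1) _ 0 ⟨
  a ∸ 1 + sum (map (_∸ 1) as) + 0                    ∎
  where open ≡-Reasoning
length-insertBlues (a ∷ as) (s ∷ q) = begin
  length (blues a ++ s ∷ insertBlues as q)           ≡⟨ length-++ (blues a) ⟩
  length (blues a) + suc (length (insertBlues as q)) ≡⟨ cong₂ (λ m n → m + suc n) (length-replicate (a ∸ 1)) (length-insertBlues as q) ⟩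
  a ∸ 1 + suc (sum (map (_∸ 1) as) + length q)       ≡⟨ cong (_+_ (a ∸ 1)) (+-suc _ (length q)) ⟨
  a ∸ 1 + (sum (map (_∸ 1) as) + suc (length q))     ≡⟨ +-assoc (a ∸ 1) _ _ ⟨
  a ∸ 1 + sum (map (_∸ 1) as) + suc (length q)       ∎
  where open ≡-Reasoning

sum-map-∸1 : ∀ {as} → All (1 ≤_) as → sum (map (_∸ 1) as) + length as ≡ sum as
sum-map-∸1 []                         = refl
sum-map-∸1 {suc a ∷ as} (s≤s z≤n ∷ ps) = begin
  a + sum (map (_∸ 1) as) + suc (length as)    ≡⟨ +-suc (a + _) (length as) ⟩
  suc (a + sum (map (_∸ 1) as) + length as)    ≡⟨ cong suc (+-assoc a _ (length as)) ⟩
  suc (a + (sum (map (_∸ 1) as) + length as))  ≡⟨ cong (λ n → suc (a + n)) (sum-map-∸1 ps) ⟩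
  suc (a + sum as)                             ∎
  where open ≡-Reasoning

suc-length-insertBlues : ∀ {as q} → Insertable as q → suc (length (insertBlues as q)) ≡ sum as
suc-length-insertBlues {as} {q} (pos , _ , len) = begin
  suc (length (insertBlues as q))          ≡⟨ cong suc (length-insertBlues as q) ⟩
  suc (sum (map (_∸ 1) as) + length q)     ≡⟨ +-suc (sum (map (_∸ 1) as)) (length q) ⟨
  sum (map (_∸ 1) as) + suc (length q)     ≡⟨ cong (_+_ (sum (map (_∸ 1) as))) len ⟨
  sum (map (_∸ 1) as) + length as          ≡⟨ sum-map-∸1 pos ⟩
  sum as                                   ∎
  where open ≡-Reasoning

Skeleton-insertable : ∀ {t q} → ValidTree t → Skeleton t q → Insertable (preMults t) q
Skeleton-insertable {t} v s = ValidTree⇒positive t v , Skeleton.nonBlue s , length-preMults s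

-- The first argument counts the blue steps already read in the current gap.
decodeFrom : ℕ → List Step → List ℕ × List Step
decodeFrom k []           = [ suc k ] , []
decodeFrom k (H blue ∷ p) = decodeFrom (suc k) p
decodeFrom k (s ∷ p)      = Product.map (suc k ∷_) (s ∷_) (decodeFrom 0 p)

decode : List Step → List ℕ × List Step
decode = decodeFrom 0

decodeFrom-nonBlue : ∀ {s} → NonBlue s → ∀ k p → decodeFrom k (s ∷ p) ≡ Product.map (suc k ∷_) (s ∷_) (decode p)
decodeFrom-nonBlue {U}       _ k p = refl
decodeFrom-nonBlue {D}       _ k p = refl
decodeFrom-nonBlue {H red}   _ k p = refl
decodeFrom-nonBlue {H green} _ k p = refl

decodeFrom-blues : ∀ n k r → decodeFrom k (replicate n (H blue) ++ r) ≡ decodeFrom (n + k) r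
decodeFrom-blues zero    k r = refl
decodeFrom-blues (suc n) k r = trans (decodeFrom-blues n (suc k) r) (cong (λ m → decodeFrom m r) (+-suc n k))

decode-insertBlues : ∀ as q → Insertable as q → decode (insertBlues as q) ≡ (as , q)
decode-insertBlues (suc a ∷ []) [] _ = begin
  decodeFrom 0 (replicate a (H blue) ++ [])  ≡⟨ decodeFrom-blues a 0 [] ⟩
  decodeFrom (a + 0) []                      ≡⟨ cong (λ m → decodeFrom m []) (+-identityʳ a) ⟩
  ([ suc a ] , [])                           ∎
  where open ≡-Reasoning
decode-insertBlues (suc a ∷ as) (s ∷ q) (_ ∷ pos , nb ∷ nbs , len) = begin
  decodeFrom 0 (replicate a (H blue) ++ s ∷ insertBlues as q)  ≡⟨ decodeFrom-blues a 0 _ ⟩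
  decodeFrom (a + 0) (s ∷ insertBlues as q)                    ≡⟨ cong (λ m → decodeFrom m (s ∷ insertBlues as q)) (+-identityʳ a) ⟩
  decodeFrom a (s ∷ insertBlues as q)                          ≡⟨ decodeFrom-nonBlue nb a _ ⟩
  Product.map (suc a ∷_) (s ∷_) (decode (insertBlues as q))    ≡⟨ cong (Product.map (suc a ∷_) (s ∷_)) (decode-insertBlues as q (pos , nbs , suc-injective len)) ⟩
  (suc a ∷ as , s ∷ q)                                         ∎
  where open ≡-Reasoning
decode-insertBlues []               _       (_ , _ , ())
decode-insertBlues (zero ∷ _)       _       (() ∷ _ , _)
decode-insertBlues (suc _ ∷ _ ∷ _)  []      (_ , _ , ())

insertBlues-decodeFrom : ∀ k p → uncurry insertBlues (decodeFrom k p) ≡ replicate k (H blue) ++ p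
insertBlues-decodeFrom k []              = refl
insertBlues-decodeFrom k (H blue ∷ p)    = trans (insertBlues-decodeFrom (suc k) p) (replicate-++-∷ k)
  where
    replicate-++-∷ : ∀ n → H blue ∷ replicate n (H blue) ++ p ≡ replicate n (H blue) ++ H blue ∷ p
    replicate-++-∷ zero    = refl
    replicate-++-∷ (suc n) = cong (H blue ∷_) (replicate-++-∷ n)
insertBlues-decodeFrom k (U ∷ p)         = cong (λ r → replicate k (H blue) ++ U ∷ r) (insertBlues-decodeFrom 0 p)
insertBlues-decodeFrom k (D ∷ p)         = cong (λ r → replicate k (H blue) ++ D ∷ r) (insertBlues-decodeFrom 0 p)
insertBlues-decodeFrom k (H red ∷ p)     = cong (λ r → replicate k (H blue) ++ H red ∷ r) (insertBlues-decodeFrom 0 p)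
insertBlues-decodeFrom k (H green ∷ p)   = cong (λ r → replicate k (H blue) ++ H green ∷ r) (insertBlues-decodeFrom 0 p)

Insertable-∷ : ∀ {k s as q} → NonBlue s → Insertable as q → Insertable (suc k ∷ as) (s ∷ q)
Insertable-∷ nb (pos , nbs , len) = s≤s z≤n ∷ pos , nb ∷ nbs , cong suc len

decodeFrom-insertable : ∀ k p → uncurry Insertable (decodeFrom k p)
decodeFrom-insertable k []            = s≤s z≤n ∷ [] , [] , refl
decodeFrom-insertable k (H blue ∷ p)  = decodeFrom-insertable (suc k) p
decodeFrom-insertable k (U ∷ p)       = Insertable-∷ tt (decodeFrom-insertable 0 p)
decodeFrom-insertable k (D ∷ p)       = Insertable-∷ tt (decodeFrom-insertable 0 p)
decodeFrom-insertable k (H red ∷ p)   = Insertable-∷ tt (decodeFrom-insertable 0 p)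
decodeFrom-insertable k (H green ∷ p) = Insertable-∷ tt (decodeFrom-insertable 0 p)

Walk-decodeFrom : ∀ k {h p} → Walk h p → Walk h (proj₂ (decodeFrom k p))
Walk-decodeFrom k done              = done
Walk-decodeFrom k (up w)            = up (Walk-decodeFrom 0 w)
Walk-decodeFrom k (down w)          = down (Walk-decodeFrom 0 w)
Walk-decodeFrom k (flat red w)      = flat red (Walk-decodeFrom 0 w)
Walk-decodeFrom k (flat green w)    = flat green (Walk-decodeFrom 0 w)
Walk-decodeFrom k (flat blue w)     = Walk-decodeFrom (suc k) w

-- Reconstructing a tree from its Dyck path and multiplicities

mutual
  dyck-preMults-injective : ∀ t t′ {r r′ ms ms′} →
    dyck t ++ D ∷ r ≡ dyck t′ ++ D ∷ r′ → preMults t ++ ms ≡ preMults t′ ++ ms′ →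
    t ≡ t′ × r ≡ r′ × ms ≡ ms′
  dyck-preMults-injective (node cs) (node cs′) p q with dyckF-preMultsF-injective cs cs′ p q
  ... | refl , r≡ , ms≡ = refl , r≡ , ms≡

  dyckF-preMultsF-injective : ∀ cs cs′ {r r′ ms ms′} →
    dyckF cs ++ D ∷ r ≡ dyckF cs′ ++ D ∷ r′ → preMultsF cs ++ ms ≡ preMultsF cs′ ++ ms′ →
    cs ≡ cs′ × r ≡ r′ × ms ≡ ms′
  dyckF-preMultsF-injective []      []       refl refl = refl , refl , refl
  dyckF-preMultsF-injective []      (_ ∷ _)  ()   _
  dyckF-preMultsF-injective (_ ∷ _) []       ()   _
  dyckF-preMultsF-injective ((a , t) ∷ cs) ((a′ , t′) ∷ cs′) {r} {r′} {ms} {ms′} p q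
    with dyck-preMults-injective t t′
           (∷-injectiveʳ (trans (sym (dyckF-∷-++ a t cs (D ∷ r))) (trans p (dyckF-∷-++ a′ t′ cs′ (D ∷ r′)))))
           (trans (sym (++-assoc (preMults t) _ ms)) (trans (∷-injectiveʳ q) (++-assoc (preMults t′) _ ms′)))
  ... | refl , r≡ , ms≡ with dyckF-preMultsF-injective cs cs′ r≡ ms≡ | ∷-injectiveˡ q
  ... | refl , r≡′ , ms≡′ | refl = refl , r≡′ , ms≡′

closing : ∀ {h} → Vec Forest h → List Step
closing []       = []
closing (cs ∷ v) = D ∷ dyckF cs ++ closing v

-- A Dyck path from height h splits at its h unmatched down-steps into h + 1 forests.
parse : ∀ {h w} → Dyck h w → Σ[ cs ∈ Forest ] Σ[ v ∈ Vec Forest h ] w ≡ dyckF cs ++ closing v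
parse done     = [] , [] , refl
parse (down d) with parse d
... | cs , v , eq = [] , cs ∷ v , cong (D ∷_) eq
parse (up d)   with parse d
... | cs₀ , cs₁ ∷ v , eq = (1 , node cs₀) ∷ cs₁ , v , trans (cong (U ∷_) eq) (sym (dyckF-∷-++ 1 (node cs₀) cs₁ (closing v)))

split-length : ∀ {A : Set} (xs : List A) m n → length xs ≡ m + n →
               Σ[ ys ∈ List A ] Σ[ zs ∈ List A ] xs ≡ ys ++ zs × length ys ≡ m × length zs ≡ n
split-length xs       zero    n len = [] , xs , refl , refl , len
split-length (x ∷ xs) (suc m) n len with split-length xs m n (suc-injective len)
... | ys , zs , refl , refl , refl = x ∷ ys , zs , refl , refl , refl

mutual
  relabel : ∀ t bs → length bs ≡ length (preMults t) →
            Σ[ t′ ∈ MTree ] dyck t′ ≡ dyck t × preMults t′ ≡ bs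
  relabel (node cs) bs len with relabelF cs bs len
  ... | cs′ , dyck≡ , preMults≡ = node cs′ , dyck≡ , preMults≡

  relabelF : ∀ cs bs → length bs ≡ length (preMultsF cs) →
             Σ[ cs′ ∈ Forest ] dyckF cs′ ≡ dyckF cs × preMultsF cs′ ≡ bs
  relabelF []             []       _   = [] , refl , refl
  relabelF ((a , t) ∷ cs) (b ∷ bs) len
    with split-length bs (length (preMults t)) (length (preMultsF cs)) (trans (suc-injective len) (length-++ (preMults t)))
  ... | ys , zs , refl , len-ys , len-zs with relabel t ys len-ys | relabelF cs zs len-zs
  ... | t′ , dyck≡ , refl | cs′ , dyckF≡ , refl =
    (b , t′) ∷ cs′ , cong₂ (λ w w′ → (U ∷ w ++ [ D ]) ++ w′) dyck≡ dyckF≡ , refl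

skeleton-realisable : ∀ {as q} → Insertable as q → Walk 0 q → ∃ λ t → preMults t ≡ as × Skeleton t q
skeleton-realisable {as} {q} (_ , nbs , len) wq with parse (up (Dyck-unpair wq nbs))
... | cs , [] , eq with relabel (node cs) as (trans len (sym (length-preMults shape)))
  where
    shape : Skeleton (node cs) q
    shape = record { walk = wq ; nonBlue = nbs ; dyck≡ = sym (trans eq (++-identityʳ (dyckF cs))) }
... | t , dyck≡ , preMults≡ = t , preMults≡ ,
  record { walk = wq ; nonBlue = nbs ; dyck≡ = trans dyck≡ (sym (trans eq (++-identityʳ (dyckF cs)))) }

-- The bijection Φ

Φ-motzkin : ∀ {n} t → ValidTree t → edges t ≡ suc n → IsMotzkin (Φ t) × length (Φ t) ≡ n
Φ-motzkin {n} (node (e ∷ cs)) v edges≡ with skeleton e cs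
... | q , s = subst IsMotzkin (sym (Φ≡insertBlues s)) (Walk-insertBlues (preMults t) (Skeleton.walk s)) , suc-injective (begin
  suc (length (Φ t))                              ≡⟨ cong (suc ∘ length) (Φ≡insertBlues s) ⟩
  suc (length (insertBlues (preMults t) q))       ≡⟨ suc-length-insertBlues (Skeleton-insertable v s) ⟩
  sum (preMults t)                                ≡⟨ edges≡sum-preMults t ⟨
  edges t                                         ≡⟨ edges≡ ⟩
  suc n                                           ∎)
  where open ≡-Reasoning
        t = node (e ∷ cs)

Φ-injective : ∀ {m n} t t′ → ValidTree t → edges t ≡ suc m → ValidTree t′ → edges t′ ≡ suc n →
              Φ t ≡ Φ t′ → t ≡ t′
Φ-injective (node (e ∷ cs)) (node (e′ ∷ cs′)) v _ v′ _ Φ≡ with skeleton e cs | skeleton e′ cs′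
... | q , s | q′ , s′ with codes≡
  where
    codes≡ : (preMults (node (e ∷ cs)) , q) ≡ (preMults (node (e′ ∷ cs′)) , q′)
    codes≡ = trans (sym (decode-insertBlues _ q (Skeleton-insertable v s)))
               (trans (cong decode (trans (sym (Φ≡insertBlues s)) (trans Φ≡ (Φ≡insertBlues s′))))
                 (decode-insertBlues _ q′ (Skeleton-insertable v′ s′)))
... | codes≡ = proj₁ (dyck-preMults-injective _ _ dyck≡ (cong (λ c → proj₁ c ++ []) codes≡))
  where
    dyck≡ : dyck (node (e ∷ cs)) ++ [ D ] ≡ dyck (node (e′ ∷ cs′)) ++ [ D ]
    dyck≡ = cong (_++ [ D ]) (trans (Skeleton.dyck≡ s)
              (trans (cong (λ c → U ∷ unpair (proj₂ c) ++ [ D ]) codes≡) (sym (Skeleton.dyck≡ s′))))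

Φ-surjective : ∀ p → IsMotzkin p → Σ[ t ∈ MTree ] ValidTree t × edges t ≡ suc (length p) × Φ t ≡ p
Φ-surjective p w with decode p | decodeFrom-insertable 0 p | Walk-decodeFrom 0 w | insertBlues-decodeFrom 0 p
... | as , q | ins@(pos , _) | wq | p≡ with skeleton-realisable ins wq
... | t , refl , s =
  t , positive⇒ValidTree t pos , edges≡ , trans (Φ≡insertBlues s) p≡
  where
    edges≡ : edges t ≡ suc (length p)
    edges≡ = trans (edges≡sum-preMults t) (trans (sym (suc-length-insertBlues ins)) (cong (suc ∘ length) p≡))

Walk-irrelevant : ∀ {h p} (w w′ : Walk h p) → w ≡ w′
Walk-irrelevant done       done        = refl
Walk-irrelevant (up w)     (up w′)     = cong up (Walk-irrelevant w w′)
Walk-irrelevant (down w)   (down w′)   = cong down (Walk-irrelevant w w′)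
Walk-irrelevant (flat c w) (flat .c w′) = cong (flat c) (Walk-irrelevant w w′)

mutual
  ValidTree-irrelevant : ∀ t (v v′ : ValidTree t) → v ≡ v′
  ValidTree-irrelevant (node cs) = ValidForest-irrelevant cs

  ValidForest-irrelevant : ∀ cs (v v′ : ValidForest cs) → v ≡ v′
  ValidForest-irrelevant []             _              _                 = refl
  ValidForest-irrelevant ((a , t) ∷ cs) (1≤a , v , vs) (1≤a′ , v′ , vs′) =
    cong₂ _,_ (≤-irrelevant 1≤a 1≤a′) (cong₂ _,_ (ValidTree-irrelevant t v v′) (ValidForest-irrelevant cs vs vs′))

Walks : ℕ → ℕ → Set
Walks h m = Σ[ p ∈ List Step ] Walk h p × length p ≡ m

Walks-≡ : ∀ {h m p p′} {w : Walk h p} {w′ : Walk h p′} {len : length p ≡ m} {len′ : length p′ ≡ m} →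
          p ≡ p′ → _≡_ {A = Walks h m} (p , w , len) (p′ , w′ , len′)
Walks-≡ {w = w} {w′} {len} {len′} refl = cong₂ (λ w len → (_ , w , len)) (Walk-irrelevant w w′) (≡-irrelevant len len′)

MultiEdgeTrees-≡ : ∀ {N t t′} {v : ValidTree t} {v′ : ValidTree t′} {e : edges t ≡ N} {e′ : edges t′ ≡ N} →
                   t ≡ t′ → _≡_ {A = MultiEdgeTrees N} (t , v , e) (t′ , v′ , e′)
MultiEdgeTrees-≡ {t = t} {v = v} {v′} {e} {e′} refl = cong₂ (λ v e → (t , v , e)) (ValidTree-irrelevant t v v′) (≡-irrelevant e e′)

MultiEdgeTrees↔MotzkinPaths : ∀ n → MultiEdgeTrees (suc n) ↔ MotzkinPaths n
MultiEdgeTrees↔MotzkinPaths n = ⤖⇒↔ (mk⤖ (injective , surjective))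
  where
    Φ′ : MultiEdgeTrees (suc n) → MotzkinPaths n
    Φ′ (t , v , e) = Φ t , Φ-motzkin t v e

    injective : Injective _≡_ _≡_ Φ′
    injective {t , v , e} {t′ , v′ , e′} eq = MultiEdgeTrees-≡ (Φ-injective t t′ v e v′ e′ (cong proj₁ eq))

    surjective : Surjective _≡_ _≡_ Φ′
    surjective (p , w , len) with Φ-surjective p w
    ... | t , v , e , Φ≡ = (t , v , trans e (cong suc len)) , λ { refl → Walks-≡ Φ≡ }

-- Counting walks

_⊎-Fin_ : ∀ {A B : Set} {m n} → A ↔ Fin m → B ↔ Fin n → (A ⊎ B) ↔ Fin (m + n)
f ⊎-Fin g = ↔-trans (f ⊎-↔ g) (↔-sym +↔⊎)

_×-Fin_ : ∀ {A B : Set} {m n} → A ↔ Fin m → B ↔ Fin n → (A × B) ↔ Fin (m * n)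
f ×-Fin g = ↔-trans (f ×-↔ g) (↔-sym *↔×)

empty↔Fin0 : ∀ {A : Set} → (A → ⊥) → A ↔ Fin 0
empty↔Fin0 ¬a = mk↔ₛ′ (⊥-elim ∘ ¬a) (λ ()) (λ ()) (⊥-elim ∘ ¬a)

Colour↔Fin3 : Colour ↔ Fin 3
Colour↔Fin3 = mk↔ₛ′ to from (λ { Fin.zero → refl ; (Fin.suc Fin.zero) → refl ; (Fin.suc (Fin.suc Fin.zero)) → refl })
                            (λ { red → refl ; green → refl ; blue → refl })
  where
    to : Colour → Fin 3
    to red   = Fin.zero
    to green = Fin.suc Fin.zero
    to blue  = Fin.suc (Fin.suc Fin.zero)

    from : Fin 3 → Colour
    from Fin.zero                  = red
    from (Fin.suc Fin.zero)        = green
    from (Fin.suc (Fin.suc _))     = blue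

Descents : ℕ → ℕ → Set
Descents zero    m = ⊥
Descents (suc h) m = Walks h m

mutual
  walkCount : ℕ → ℕ → ℕ
  walkCount h       (suc m) = walkCount (suc h) m + descentCount h m + 3 * walkCount h m
  walkCount zero    zero    = 1
  walkCount (suc h) zero    = 0

  descentCount : ℕ → ℕ → ℕ
  descentCount zero    m = 0
  descentCount (suc h) m = walkCount h m

Walks-suc↔ : ∀ h m → Walks h (suc m) ↔ ((Walks (suc h) m ⊎ Descents h m) ⊎ (Colour × Walks h m))
Walks-suc↔ h m = mk↔ₛ′ to from to∘from from∘to
  where
    to : ∀ {h} → Walks h (suc m) → (Walks (suc h) m ⊎ Descents h m) ⊎ (Colour × Walks h m)
    to (U ∷ p   , up w     , len) = inj₁ (inj₁ (p , w , suc-injective len))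
    to (D ∷ p   , down w   , len) = inj₁ (inj₂ (p , w , suc-injective len))
    to (H c ∷ p , flat c w , len) = inj₂ (c , p , w , suc-injective len)

    from : ∀ {h} → (Walks (suc h) m ⊎ Descents h m) ⊎ (Colour × Walks h m) → Walks h (suc m)
    from         (inj₁ (inj₁ (p , w , len))) = U ∷ p , up w , cong suc len
    from {suc h} (inj₁ (inj₂ (p , w , len))) = D ∷ p , down w , cong suc len
    from         (inj₂ (c , p , w , len))    = H c ∷ p , flat c w , cong suc len

    to∘from : ∀ {h} x → to {h} (from x) ≡ x
    to∘from         (inj₁ (inj₁ _)) = cong (inj₁ ∘ inj₁) (Walks-≡ refl)
    to∘from {suc h} (inj₁ (inj₂ _)) = cong (inj₁ ∘ inj₂) (Walks-≡ refl)
    to∘from         (inj₂ (c , _))  = cong (inj₂ ∘ (c ,_)) (Walks-≡ refl)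

    from∘to : ∀ {h} x → from {h} (to x) ≡ x
    from∘to (U ∷ _ , up _     , _) = Walks-≡ refl
    from∘to (D ∷ _ , down _   , _) = Walks-≡ refl
    from∘to (H _ ∷ _ , flat _ _ , _) = Walks-≡ refl

mutual
  Walks↔Fin : ∀ h m → Walks h m ↔ Fin (walkCount h m)
  Walks↔Fin zero    zero    = mk↔ₛ′ (λ _ → Fin.zero) (λ _ → [] , done , refl)
                                    (λ { Fin.zero → refl ; (Fin.suc ()) }) (λ { ([] , done , refl) → refl })
  Walks↔Fin (suc h) zero    = empty↔Fin0 λ { ([] , () , _) }
  Walks↔Fin h       (suc m) = ↔-trans (Walks-suc↔ h m)
    ((Walks↔Fin (suc h) m ⊎-Fin Descents↔Fin h m) ⊎-Fin (Colour↔Fin3 ×-Fin Walks↔Fin h m))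

  Descents↔Fin : ∀ h m → Descents h m ↔ Fin (descentCount h m)
  Descents↔Fin zero    m = empty↔Fin0 λ ()
  Descents↔Fin (suc h) m = Walks↔Fin h m

Convolution : (ℕ → Set) → (ℕ → Set) → ℕ → Set
Convolution A B n = Σ[ i ∈ ℕ ] Σ[ j ∈ ℕ ] i + j ≡ n × A i × B j

convolution : (ℕ → ℕ) → (ℕ → ℕ) → ℕ → ℕ
convolution a b n = sum (applyUpTo (λ i → a i * b (n ∸ i)) (suc n))

Convolution-zero↔ : ∀ {A B} → Convolution A B 0 ↔ ((A 0 × B 0) ⊎ ⊥)
Convolution-zero↔ {A} {B} = mk↔ₛ′ to from (λ { (inj₁ _) → refl }) (λ { (0 , 0 , refl , _) → refl })
  where
    to : Convolution A B 0 → (A 0 × B 0) ⊎ ⊥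
    to (0 , 0 , refl , x , y) = inj₁ (x , y)

    from : (A 0 × B 0) ⊎ ⊥ → Convolution A B 0
    from (inj₁ (x , y)) = 0 , 0 , refl , x , y

Convolution-suc↔ : ∀ {A B n} → Convolution A B (suc n) ↔ ((A 0 × B (suc n)) ⊎ Convolution (A ∘ suc) B n)
Convolution-suc↔ {A} {B} {n} = mk↔ₛ′ to from to∘from from∘to
  where
    to : Convolution A B (suc n) → (A 0 × B (suc n)) ⊎ Convolution (A ∘ suc) B n
    to (0     , j , refl , x , y) = inj₁ (x , y)
    to (suc i , j , eq   , x , y) = inj₂ (i , j , suc-injective eq , x , y)

    from : (A 0 × B (suc n)) ⊎ Convolution (A ∘ suc) B n → Convolution A B (suc n)
    from (inj₁ (x , y))             = 0 , suc n , refl , x , y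
    from (inj₂ (i , j , eq , x , y)) = suc i , j , cong suc eq , x , y

    to∘from : ∀ z → to (from z) ≡ z
    to∘from (inj₁ _)                  = refl
    to∘from (inj₂ (i , j , refl , _)) = refl

    from∘to : ∀ z → from (to z) ≡ z
    from∘to (0     , j , refl , _) = refl
    from∘to (suc i , j , refl , _) = refl

Convolution↔Fin : ∀ {A B : ℕ → Set} {a b} → (∀ i → A i ↔ Fin (a i)) → (∀ j → B j ↔ Fin (b j)) →
                  ∀ n → Convolution A B n ↔ Fin (convolution a b n)
Convolution↔Fin fA fB zero    = ↔-trans Convolution-zero↔ ((fA 0 ×-Fin fB 0) ⊎-Fin empty↔Fin0 λ ())
Convolution↔Fin fA fB (suc n) = ↔-trans Convolution-suc↔ ((fA 0 ×-Fin fB (suc n)) ⊎-Fin Convolution↔Fin (fA ∘ suc) fB n)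

Walk-++ : ∀ {h k q r} → Walk h q → Walk k r → Walk (h + k) (q ++ r)
Walk-++ done       w = w
Walk-++ (up v)     w = up (Walk-++ v w)
Walk-++ (down v)   w = down (Walk-++ v w)
Walk-++ (flat c v) w = flat c (Walk-++ v w)

-- Split a path at its first down-step that ends d + 1 levels below the start.
splitAtReturn : ℕ → List Step → List Step × List Step
splitAtReturn d       []        = [] , []
splitAtReturn d       (U ∷ p)   = Product.map₁ (U ∷_) (splitAtReturn (suc d) p)
splitAtReturn zero    (D ∷ p)   = [] , p
splitAtReturn (suc d) (D ∷ p)   = Product.map₁ (D ∷_) (splitAtReturn d p)
splitAtReturn d       (H c ∷ p) = Product.map₁ (H c ∷_) (splitAtReturn d p)

splitAtReturn-++ : ∀ {d q} r → Walk d q → splitAtReturn d (q ++ D ∷ r) ≡ (q , r)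
splitAtReturn-++ r done       = refl
splitAtReturn-++ r (up w)     = cong (Product.map₁ (U ∷_)) (splitAtReturn-++ r w)
splitAtReturn-++ r (down w)   = cong (Product.map₁ (D ∷_)) (splitAtReturn-++ r w)
splitAtReturn-++ r (flat c w) = cong (Product.map₁ (H c ∷_)) (splitAtReturn-++ r w)

splitAtReturn-Walk : ∀ d {h p} → Walk (d + suc h) p →
  p ≡ proj₁ (splitAtReturn d p) ++ D ∷ proj₂ (splitAtReturn d p) × Walk d (proj₁ (splitAtReturn d p)) × Walk h (proj₂ (splitAtReturn d p))
splitAtReturn-Walk zero    (down w) = refl , done , w
splitAtReturn-Walk (suc d) (down w) with splitAtReturn-Walk d w
... | eq , wq , wr = cong (D ∷_) eq , down wq , wr
splitAtReturn-Walk d       (up w) with splitAtReturn-Walk (suc d) w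
... | eq , wq , wr = cong (U ∷_) eq , up wq , wr
splitAtReturn-Walk d       (flat c w) with splitAtReturn-Walk d w
... | eq , wq , wr = cong (H c ∷_) eq , flat c wq , wr

Walks-one↔ : ∀ n → Walks 1 (suc n) ↔ Convolution (Walks 0) (Walks 0) n
Walks-one↔ n = mk↔ₛ′ to from to∘from from∘to
  where
    length-split : ∀ q r → length (q ++ D ∷ r) ≡ suc (length q + length r)
    length-split q r = trans (length-++ q) (+-suc (length q) (length r))

    to : Walks 1 (suc n) → Convolution (Walks 0) (Walks 0) n
    to (p , w , len) = length q , length r , suc-injective (trans (sym (length-split q r)) (trans (cong length (sym eq)) len))
                     , (q , wq , refl) , (r , wr , refl)
      where
        q = proj₁ (splitAtReturn 0 p)
        r = proj₂ (splitAtReturn 0 p)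
        eq = proj₁ (splitAtReturn-Walk 0 w)
        wq = proj₁ (proj₂ (splitAtReturn-Walk 0 w))
        wr = proj₂ (proj₂ (splitAtReturn-Walk 0 w))

    from : Convolution (Walks 0) (Walks 0) n → Walks 1 (suc n)
    from (_ , _ , lens , (q , wq , refl) , (r , wr , refl)) = q ++ D ∷ r , Walk-++ wq (down wr) , trans (length-split q r) (cong suc lens)

    split-≡ : ∀ {q q′ r r′ wq wq′ wr wr′ lens lens′} → q ≡ q′ → r ≡ r′ →
      _≡_ {A = Convolution (Walks 0) (Walks 0) n}
          (length q , length r , lens , (q , wq , refl) , (r , wr , refl))
          (length q′ , length r′ , lens′ , (q′ , wq′ , refl) , (r′ , wr′ , refl))
    split-≡ {wq = wq} {wq′} {wr} {wr′} {lens} {lens′} refl refl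
      rewrite Walk-irrelevant wq wq′ | Walk-irrelevant wr wr′ | ≡-irrelevant lens lens′ = refl

    to∘from : ∀ x → to (from x) ≡ x
    to∘from (_ , _ , _ , (q , wq , refl) , (r , wr , refl)) =
      split-≡ (cong proj₁ (splitAtReturn-++ r wq)) (cong proj₂ (splitAtReturn-++ r wq))

    from∘to : ∀ x → from (to x) ≡ x
    from∘to (p , w , _) = Walks-≡ (sym (proj₁ (splitAtReturn-Walk 0 w)))

motzkin : ℕ → ℕ
motzkin = walkCount 0

walkCount-one : ∀ n → walkCount 1 (suc n) ≡ convolution motzkin motzkin n
walkCount-one n = ↔⇒≡ (↔-trans (↔-sym (Walks↔Fin 1 (suc n)))
                        (↔-trans (Walks-one↔ n) (Convolution↔Fin (Walks↔Fin 0) (Walks↔Fin 0) n)))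

motzkin-suc : ∀ m → motzkin (suc m) ≡ sum (applyUpTo (λ i → motzkin i * motzkin (m ∸ suc i)) m) + 3 * motzkin m
motzkin-suc zero    = refl
motzkin-suc (suc n) = cong (λ c → c + 3 * motzkin (suc n)) (trans (+-identityʳ _) (walkCount-one n))

-- The coefficients of √(1 - 6z + 5z²)

ι : ℕ → ℚ
ι n = + n / 1

ι≡mkℚ : ∀ n → ι n ≡ mkℚ (+ n) 0 (Coprimality.sym (Coprimality.1-coprimeTo n))
ι≡mkℚ n = ℚ.normalize-coprime (Coprimality.sym (Coprimality.1-coprimeTo n))

-- Once ι m and ι n are written in normal form, their sum and product unfold to the fractions below.
ι-+ : ∀ m n → ι (m + n) ≡ ι m ℚ.+ ι n
ι-+ m n = begin
  + (m + n) / 1                                ≡⟨ ℚ./-cong (sym (cong₂ ℤ._+_ (ℤ.*-identityʳ (+ m)) (ℤ.*-identityʳ (+ n)))) refl ⟩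
  (+ m ℤ.* + 1 ℤ.+ + n ℤ.* + 1) / (1 * 1)      ≡⟨ cong₂ ℚ._+_ (ι≡mkℚ m) (ι≡mkℚ n) ⟨
  ι m ℚ.+ ι n                                  ∎
  where open ≡-Reasoning

ι-* : ∀ m n → ι (m * n) ≡ ι m ℚ.* ι n
ι-* m n = begin
  + (m * n) / 1                 ≡⟨ ℚ./-cong (ℤ.pos-* m n) refl ⟩
  (+ m ℤ.* + n) / (1 * 1)       ≡⟨ cong₂ ℚ._*_ (ι≡mkℚ m) (ι≡mkℚ n) ⟨
  ι m ℚ.* ι n                   ∎
  where open ≡-Reasoning

sumℚ-∷ʳ : ∀ xs y → sumℚ (xs ++ [ y ]) ≡ sumℚ xs ℚ.+ y
sumℚ-∷ʳ []       y = trans (ℚ.+-identityʳ y) (sym (ℚ.+-identityˡ y))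
sumℚ-∷ʳ (x ∷ xs) y = trans (cong (x ℚ.+_) (sumℚ-∷ʳ xs y)) (sym (ℚ.+-assoc x (sumℚ xs) y))

sumℚ-upTo-ends : ∀ (f : ℕ → ℚ) m →
  sumℚ (map f (upTo (suc (suc m)))) ≡ f 0 ℚ.+ (sumℚ (applyUpTo (f ∘ suc) m) ℚ.+ f (suc m))
sumℚ-upTo-ends f m = cong (f 0 ℚ.+_) (begin
  sumℚ (map f (applyUpTo suc (suc m)))               ≡⟨ cong sumℚ (map-applyUpTo suc f (suc m)) ⟩
  sumℚ (applyUpTo (f ∘ suc) (suc m))                 ≡⟨ cong sumℚ (applyUpTo-∷ʳ (f ∘ suc) m) ⟨
  sumℚ (applyUpTo (f ∘ suc) m ++ [ f (suc m) ])      ≡⟨ sumℚ-∷ʳ (applyUpTo (f ∘ suc) m) (f (suc m)) ⟩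
  sumℚ (applyUpTo (f ∘ suc) m) ℚ.+ f (suc m)         ∎)
  where open ≡-Reasoning

sumℚ-applyUpTo-ι : ∀ c (f : ℕ → ℚ) (g : ℕ → ℕ) m → (∀ {i} → i < m → f i ≡ c ℚ.* ι (g i)) →
                   sumℚ (applyUpTo f m) ≡ c ℚ.* ι (sum (applyUpTo g m))
sumℚ-applyUpTo-ι c f g zero    _  = sym (ℚ.*-zeroʳ c)
sumℚ-applyUpTo-ι c f g (suc m) f≡ = begin
  f 0 ℚ.+ sumℚ (applyUpTo (f ∘ suc) m)                      ≡⟨ cong₂ ℚ._+_ (f≡ z<s) (sumℚ-applyUpTo-ι c (f ∘ suc) (g ∘ suc) m (f≡ ∘ s<s)) ⟩
  c ℚ.* ι (g 0) ℚ.+ c ℚ.* ι (sum (applyUpTo (g ∘ suc) m))   ≡⟨ ℚ.*-distribˡ-+ c (ι (g 0)) _ ⟨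
  c ℚ.* (ι (g 0) ℚ.+ ι (sum (applyUpTo (g ∘ suc) m)))       ≡⟨ cong (c ℚ.*_) (ι-+ (g 0) _) ⟨
  c ℚ.* ι (sum (applyUpTo g (suc m)))                       ∎
  where open ≡-Reasoning

sqrtStep : (ℕ → ℚ) → ℕ → ℚ
sqrtStep g n = (hCoef (suc n) ℚ.- sumℚ (map (λ i → g (suc i) ℚ.* g (n ∸ i)) (upTo n))) ℚ.* ½

sqrtStep-cong : ∀ {f g} n → (∀ {i} → i ≤ n → f i ≡ g i) → sqrtStep f n ≡ sqrtStep g n
sqrtStep-cong n f≡g = cong (λ s → (hCoef (suc n) ℚ.- sumℚ s) ℚ.* ½)
  (map-cong-local (All.applyUpTo⁺₁ id n (λ {i} i<n → cong₂ ℚ._*_ (f≡g i<n) (f≡g (m∸n≤m n i)))))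

at-++ˡ : ∀ xs ys {j} → j < length xs → at (xs ++ ys) j ≡ at xs j
at-++ˡ (x ∷ xs) ys {zero}  _         = refl
at-++ˡ (x ∷ xs) ys {suc j} (s≤s j<n) = at-++ˡ xs ys j<n

at-++-length : ∀ xs y {k} → length xs ≡ k → at (xs ++ [ y ]) k ≡ y
at-++-length []       y refl = refl
at-++-length (x ∷ xs) y refl = at-++-length xs y refl

length-sqrtPrefix : ∀ n → length (sqrtPrefix n) ≡ suc n
length-sqrtPrefix zero    = refl
length-sqrtPrefix (suc n) = trans (length-++ (sqrtPrefix n)) (trans (cong (_+ 1) (length-sqrtPrefix n)) (+-comm (suc n) 1))

at-sqrtPrefix : ∀ {j n} → j ≤ n → at (sqrtPrefix n) j ≡ sqrtCoef j
at-sqrtPrefix {n = zero}  z≤n = refl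
at-sqrtPrefix {n = suc n} j≤  with m≤n⇒m<n∨m≡n j≤
... | inj₁ (s≤s j≤n) = trans (at-++ˡ (sqrtPrefix n) _ (subst (_ <_) (sym (length-sqrtPrefix n)) (s≤s j≤n))) (at-sqrtPrefix j≤n)
... | inj₂ refl      = refl

sqrtCoef-suc : ∀ n → sqrtCoef (suc n) ≡ sqrtStep sqrtCoef n
sqrtCoef-suc n = trans (at-++-length (sqrtPrefix n) _ (length-sqrtPrefix n)) (sqrtStep-cong n at-sqrtPrefix)

sqrtCoef-unique : ∀ g → g 0 ≡ 1ℚ → (∀ n → g (suc n) ≡ sqrtStep g n) → ∀ n → sqrtCoef n ≡ g n
sqrtCoef-unique g g₀ g-step n = upTo-≤ n ≤-refl
  where
    upTo-≤ : ∀ n {j} → j ≤ n → sqrtCoef j ≡ g j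
    upTo-≤ zero    z≤n = sym g₀
    upTo-≤ (suc n) j≤  with m≤n⇒m<n∨m≡n j≤
    ... | inj₁ (s≤s j≤n) = upTo-≤ n j≤n
    ... | inj₂ refl      = trans (sqrtCoef-suc n) (trans (sqrtStep-cong n (upTo-≤ n)) (sym (g-step n)))

-- √(1 - 6z + 5z²) = 1 - 3z - 2 Σ M(m) z^(m+2), where M(m) counts Motzkin paths of length m.
motzkinSqrtCoef : ℕ → ℚ
motzkinSqrtCoef zero          = 1ℚ
motzkinSqrtCoef (suc zero)    = ℚ.- ι 3
motzkinSqrtCoef (suc (suc m)) = ℚ.- (ι 2 ℚ.* ι (motzkin m))

motzkinSqrtCoef-step : ∀ n → motzkinSqrtCoef (suc n) ≡ sqrtStep motzkinSqrtCoef n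
motzkinSqrtCoef-step zero          = refl
motzkinSqrtCoef-step (suc zero)    = refl
motzkinSqrtCoef-step (suc (suc m)) = sym (begin
  (0ℚ ℚ.- sumℚ (map f (upTo (suc (suc m))))) ℚ.* ½
    ≡⟨ cong (λ s → (0ℚ ℚ.- s) ℚ.* ½) (sumℚ-upTo-ends f m) ⟩
  (0ℚ ℚ.- (g₁ ℚ.* g m ℚ.+ (sumℚ (applyUpTo (f ∘ suc) m) ℚ.+ g m ℚ.* motzkinSqrtCoef (suc m ∸ m)))) ℚ.* ½
    ≡⟨ cong₂ (λ s k → (0ℚ ℚ.- (g₁ ℚ.* g m ℚ.+ (s ℚ.+ g m ℚ.* motzkinSqrtCoef k))) ℚ.* ½)
             (sumℚ-applyUpTo-ι (ι 4) (f ∘ suc) _ m middle) (m+n∸n≡m 1 m) ⟩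
  (0ℚ ℚ.- (g₁ ℚ.* g m ℚ.+ (ι 4 ℚ.* ι C ℚ.+ g m ℚ.* g₁))) ℚ.* ½
    ≡⟨ collect (ι (motzkin m)) (ι C) ⟩
  ℚ.- (ι 2 ℚ.* (ι C ℚ.+ ι 3 ℚ.* ι (motzkin m)))
    ≡⟨ cong (λ x → ℚ.- (ι 2 ℚ.* x)) (trans (cong (ι C ℚ.+_) (sym (ι-* 3 (motzkin m)))) (sym (ι-+ C _))) ⟩
  ℚ.- (ι 2 ℚ.* ι (C + 3 * motzkin m))
    ≡⟨ cong (λ x → ℚ.- (ι 2 ℚ.* ι x)) (motzkin-suc m) ⟨
  motzkinSqrtCoef (suc (suc (suc m)))  ∎)
  where
    open ≡-Reasoning
    open +-*-Solver
    g : ℕ → ℚ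
    g m = motzkinSqrtCoef (suc (suc m))
    g₁ = motzkinSqrtCoef 1
    f : ℕ → ℚ
    f i = motzkinSqrtCoef (suc i) ℚ.* motzkinSqrtCoef (suc (suc m) ∸ i)
    C = sum (applyUpTo (λ i → motzkin i * motzkin (m ∸ suc i)) m)

    ∸-suc : ∀ {i m} → i < m → suc m ∸ i ≡ suc (suc (m ∸ suc i))
    ∸-suc {zero}  {suc m} _         = refl
    ∸-suc {suc i} {suc m} (s≤s i<m) = ∸-suc i<m

    middle : ∀ {i} → i < m → f (suc i) ≡ ι 4 ℚ.* ι (motzkin i * motzkin (m ∸ suc i))
    middle {i} i<m = begin
      g i ℚ.* motzkinSqrtCoef (suc m ∸ i)                        ≡⟨ cong (λ k → g i ℚ.* motzkinSqrtCoef k) (∸-suc i<m) ⟩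
      g i ℚ.* g (m ∸ suc i)                                      ≡⟨ square (ι (motzkin i)) (ι (motzkin (m ∸ suc i))) ⟩
      ι 4 ℚ.* (ι (motzkin i) ℚ.* ι (motzkin (m ∸ suc i)))        ≡⟨ cong (ι 4 ℚ.*_) (ι-* (motzkin i) _) ⟨
      ι 4 ℚ.* ι (motzkin i * motzkin (m ∸ suc i))                ∎
      where
        square : ∀ x y → ℚ.- (ι 2 ℚ.* x) ℚ.* ℚ.- (ι 2 ℚ.* y) ≡ ι 4 ℚ.* (x ℚ.* y)
        square = solve 2 (λ x y → (:- (con (ι 2) :* x)) :* (:- (con (ι 2) :* y)) := con (ι 4) :* (x :* y)) refl

    collect : ∀ a c → (0ℚ ℚ.- (g₁ ℚ.* ℚ.- (ι 2 ℚ.* a) ℚ.+ (ι 4 ℚ.* c ℚ.+ ℚ.- (ι 2 ℚ.* a) ℚ.* g₁))) ℚ.* ½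
                      ≡ ℚ.- (ι 2 ℚ.* (c ℚ.+ ι 3 ℚ.* a))
    collect = solve 2 (λ a c → (con 0ℚ :- (con g₁ :* (:- (con (ι 2) :* a)) :+ (con (ι 4) :* c :+ (:- (con (ι 2) :* a)) :* con g₁))) :* con ½
                               := :- (con (ι 2) :* (c :+ con (ι 3) :* a))) refl

FCoef≡motzkin : ∀ n → FCoef (suc n) ≡ ι (motzkin n)
FCoef≡motzkin n = begin
  (0ℚ ℚ.- sqrtCoef (suc (suc n))) ℚ.* ½                ≡⟨ cong (λ x → (0ℚ ℚ.- x) ℚ.* ½) (sqrtCoef-unique motzkinSqrtCoef refl motzkinSqrtCoef-step (suc (suc n))) ⟩
  (0ℚ ℚ.- ℚ.- (ι 2 ℚ.* ι (motzkin n))) ℚ.* ½           ≡⟨ halve (ι (motzkin n)) ⟩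
  ι (motzkin n)                                         ∎
  where
    open ≡-Reasoning
    open +-*-Solver
    halve : ∀ a → (0ℚ ℚ.- ℚ.- (ι 2 ℚ.* a)) ℚ.* ½ ≡ a
    halve = solve 1 (λ a → (con 0ℚ :- (:- (con (ι 2) :* a))) :* con ½ := a) refl

mainTheorem1 : (N : ℕ) → 1 ≤ N →
    -- Φ maps multi-edge trees with N edges to 3-coloured Motzkin paths of length N-1
    ((t : MTree) → ValidTree t → edges t ≡ N → IsMotzkin (Φ t) × length (Φ t) ≡ N ∸ 1)
    -- Φ is injective on multi-edge trees with N edges
    × ((t t′ : MTree) → ValidTree t → edges t ≡ N → ValidTree t′ → edges t′ ≡ N →
         Φ t ≡ Φ t′ → t ≡ t′)
    -- Φ is surjective onto 3-coloured Motzkin paths of length N-1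
    × ((p : List Step) → IsMotzkin p → length p ≡ N ∸ 1 →
         Σ MTree (λ t → ValidTree t × edges t ≡ N × Φ t ≡ p))
    -- both sets have cardinality [z^N] F(z)
    × Σ ℕ (λ k → (MultiEdgeTrees N ↔ Fin k) × (MotzkinPaths (N ∸ 1) ↔ Fin k) × (+ k / 1 ≡ FCoef N))
mainTheorem1 (suc n) _ = Φ-motzkin , Φ-injective , surjective ,
  (motzkin n , ↔-trans (MultiEdgeTrees↔MotzkinPaths n) (Walks↔Fin 0 n) , Walks↔Fin 0 n , sym (FCoef≡motzkin n))
  where
    surjective : (p : List Step) → IsMotzkin p → length p ≡ n →
                 Σ MTree (λ t → ValidTree t × edges t ≡ suc n × Φ t ≡ p)
    surjective p w refl = Φ-surjective p w
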